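{- A permutation $\pi\in\mathbf{S}_{n+1}$ is the suffix array of a word $w\sharp$ where $w\in\Sigma^n$ if and only if (i) $|\{\,i\in[1,n] : \Phi(\pi)(i)>\Phi(\pi)(i+1)\,\}\setminus\{1\}|\leq k-1$, and (ii) $\pi(1)=n+1$.
   Context: $\Sigma=\{a_1<a_2<\dots<a_k\}$ is an ordered alphabet of size $k$ and $\sharp\notin\Sigma$ is a sentinel symbol with $\sharp<a_1$. $\mathbf{S}_m$ is the set of permutations of $[1,m]$. The suffix array of a word $u=u_1\dots u_m$ is the permutation $\pi$ with $\pi(i)=j$ iff $u_j\dots u_m$ is the $i$-th suffix of $u$ in lexicographic order. For $\pi\in\mathbf{S}_m$ the linking permutation is $\Phi(\pi)=\pi^{ -1}(\pi+1)$, i.e. $\Phi(\pi)(i)=\pi^{ -1}(\pi(i)+1)$ where values are taken cyclically ($m+1\equiv 1$). -}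

module Defs where

open import Data.Nat using (ℕ; zero; suc)
open import Data.Fin using (Fin; zero; suc; inject₁; fromℕ; toℕ; _<_)
open import Data.Fin.Permutation using (Permutation′; _⟨$⟩ʳ_; _⟨$⟩ˡ_)
open import Data.Vec using (Vec; toList; _∷ʳ_; map)
open import Data.List using (List; drop; length; filter)
open import Data.List.Relation.Binary.Lex.Strict using (Lex-<)
open import Data.Product using (_×_)
open import Data.Fin.Properties using (_<?_)
open import Relation.Nullary using (¬_)
open import Relation.Nullary.Decidable using (_×-dec_; ¬?)
open import Relation.Binary.PropositionalEquality using (_≡_)
open import Data.Nat.Properties using (_≟_)
open import Data.List using (allFin)

-- Conventions: positions and alphabet are 0-based.
-- The extended alphabet Σ ∪ {♯} of size k+1 is Fin (suc k), with ♯ = zero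
-- and a_j = suc (j-1); thus ♯ < a_1 < ... < a_k.

sharp : ∀ {k n} → Vec (Fin k) n → Vec (Fin (suc k)) (suc n)
sharp w = map suc w ∷ʳ zero

suffix : ∀ {A : Set} {m} → Vec A m → Fin m → List A
suffix u j = drop (toℕ j) (toList u)

_<lex_ : ∀ {k} → List (Fin k) → List (Fin k) → Set
_<lex_ = Lex-< _≡_ _<_

IsSuffixArray : ∀ {k m} → Vec (Fin k) m → Permutation′ m → Set
IsSuffixArray {m = m} u π =
  ∀ (i j : Fin m) → i < j → suffix u (π ⟨$⟩ʳ i) <lex suffix u (π ⟨$⟩ʳ j)

-- cyclic successor on Fin (suc n): i ↦ i+1, last ↦ zero
csucc : ∀ {n} → Fin (suc n) → Fin (suc n)
csucc {zero} zero = zero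
csucc {suc n} zero = suc zero
csucc {suc n} (suc i) with csucc {n} i
... | zero = zero
... | suc j = suc (suc j)

Φ : ∀ {m} → Permutation′ (suc m) → Fin (suc m) → Fin (suc m)
Φ π i = π ⟨$⟩ˡ csucc (π ⟨$⟩ʳ i)

-- |{ i ∈ [1,n] : Φ(π)(i) > Φ(π)(i+1) } \ {1}|   (1-based i; here i' = i-1 : Fin n)
descentCount : ∀ {n} → Permutation′ (suc n) → ℕ
descentCount {n} π =
  length (filter (λ i → ¬? (toℕ i ≟ 0) ×-dec (Φ π (suc i) <? Φ π (inject₁ i))) (allFin n))

-- Let ℓ(r) be the first letter of the suffix of rank r. Along the ranks ℓ never decreases, and when
-- two consecutive ranks r, r+1 other than the sentinel's carry the same letter their suffixes are
-- ordered by their tails, i.e. Φ(r) < Φ(r+1). So every descent of Φ forces ℓ to go up, and the k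
-- letters leave room for at most k−1 of them; the sentinel suffix, being the smallest, has rank 1.
-- Conversely, give the position of rank r the letter "number of descents below r". Two suffixes
-- with the same first letter then have no descent between their ranks, Φ increases on that run,
-- and comparing them reduces to comparing their tails: an induction on the starting position
-- from the right.

module Submission where

open import Defs
open import Data.Nat using (ℕ; suc; _≤_; _∸_)
open import Data.Fin using (Fin; zero; fromℕ)
open import Data.Fin.Permutation using (Permutation′; _⟨$⟩ʳ_)
open import Data.Vec using (Vec)
open import Data.Product using (_×_; ∃)
open import Function.Bundles using (_⇔_)
open import Relation.Binary.PropositionalEquality using (_≡_)

open import Level using (Level; 0ℓ)
open import Data.Bool.Base using (true; false)
open import Data.Nat as ℕ using (zero; _+_; z≤n; s≤s)
import Data.Nat.Properties as ℕ
open import Data.Fin as Fin using (suc; inject₁; toℕ; fromℕ<; _<_)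
import Data.Fin.Properties as Fin
open import Data.Fin.Induction using (<-weakInduction; >-weakInduction)
open import Data.Fin.Relation.Unary.Top using (view; ‵fromℕ; ‵inject₁)
open import Data.Fin.Permutation using (_⟨$⟩ˡ_; inverseˡ; inverseʳ)
open import Function.Properties.Inverse using (↔⇒↣)
open import Data.Vec as Vec using (_∷_; []; lookup; tabulate)
import Data.Vec.Properties as Vec
open import Data.List using (List; _∷_; []; filter; length)
import Data.List as List
open import Data.List.Relation.Binary.Lex.Core using (this; next)
import Data.List.Relation.Binary.Lex.Strict as Lex
import Data.List.Relation.Binary.Pointwise as Pointwise
open import Data.Product using (_,_)
open import Data.Sum using (_⊎_; inj₁; inj₂)
open import Function using (_∘_)
open import Function.Bundles using (mk⇔; Injection)
open import Relation.Binary using (tri<; tri≈; tri>)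
open import Relation.Nullary using (¬_; yes; no; contradiction)
open import Relation.Nullary.Decidable using (does; _×-dec_; ¬?)
open import Relation.Unary using (Pred; Decidable)
open import Relation.Binary.PropositionalEquality
  using (_≢_; refl; sym; trans; cong; cong₂; subst; subst₂; module ≡-Reasoning)

private
  variable
    a p : Level
    A : Set a
    k n : ℕ

countBelow : {P : Pred (Fin n) p} → Decidable P → Fin (suc n) → ℕ
countBelow P? zero = 0
countBelow {n = suc n} P? (suc r) with does (P? zero)
... | true  = suc (countBelow (P? ∘ suc) r)
... | false = countBelow (P? ∘ suc) r

length-filter-tabulate : {P : Pred A p} (P? : Decidable P) (f : Fin n → A) →
  length (filter P? (List.tabulate f)) ≡ countBelow (P? ∘ f) (fromℕ n)
length-filter-tabulate {n = zero}  P? f = refl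
length-filter-tabulate {n = suc n} P? f with does (P? (f zero))
... | true  = cong suc (length-filter-tabulate P? (f ∘ suc))
... | false = length-filter-tabulate P? (f ∘ suc)

countBelow-accept : {P : Pred (Fin n) p} (P? : Decidable P) {i : Fin n} → P i →
  countBelow P? (suc i) ≡ suc (countBelow P? (inject₁ i))
countBelow-accept P? {zero} Pi with P? zero
... | yes _   = refl
... | no ¬Pi = contradiction Pi ¬Pi
countBelow-accept P? {suc i} Pi with does (P? zero)
... | true  = cong suc (countBelow-accept (P? ∘ suc) Pi)
... | false = countBelow-accept (P? ∘ suc) Pi

countBelow-mono : {P : Pred (Fin n) p} (P? : Decidable P) {r s : Fin (suc n)} → r Fin.≤ s →
  countBelow P? r ≤ countBelow P? s
countBelow-mono P? {zero} _ = z≤n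
countBelow-mono {n = suc n} P? {suc r} {suc s} (s≤s r≤s) with does (P? zero)
... | true  = s≤s (countBelow-mono (P? ∘ suc) r≤s)
... | false = countBelow-mono (P? ∘ suc) r≤s

countBelow-plateau : {P : Pred (Fin n) p} (P? : Decidable P) {r s : Fin (suc n)} {i : Fin n} →
  countBelow P? r ≡ countBelow P? s → r Fin.≤ inject₁ i → suc i Fin.≤ s → ¬ P i
countBelow-plateau P? {r} {s} {i} r≈s r≤i 1+i≤s Pi = ℕ.<-irrefl r≈s (begin-strict
  countBelow P? r           ≤⟨ countBelow-mono P? r≤i ⟩
  countBelow P? (inject₁ i) <⟨ ℕ.≤-reflexive (sym (countBelow-accept P? Pi)) ⟩
  countBelow P? (suc i)     ≤⟨ countBelow-mono P? 1+i≤s ⟩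
  countBelow P? s           ∎)
  where open ℕ.≤-Reasoning

countBelow-growth : {P : Pred (Fin n) p} (P? : Decidable P) (ℓ : Fin (suc n) → ℕ) →
  (∀ i → ℓ (inject₁ i) ≤ ℓ (suc i)) → (∀ i → P i → ℓ (inject₁ i) ℕ.< ℓ (suc i)) →
  ∀ r → countBelow P? r + ℓ zero ≤ ℓ r
countBelow-growth P? ℓ mono strict zero = ℕ.≤-refl
countBelow-growth {n = suc n} P? ℓ mono strict (suc r) =
  ℕ.≤-trans first-step (countBelow-growth (P? ∘ suc) (ℓ ∘ suc) (mono ∘ suc) (strict ∘ suc) r)
  where
  c = countBelow (P? ∘ suc) r
  first-step : countBelow P? (suc r) + ℓ zero ≤ c + ℓ (suc zero)
  first-step with P? zero
  ... | yes P0 = ℕ.+-monoʳ-< c (strict zero P0)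
  ... | no _   = ℕ.+-monoʳ-≤ c (mono zero)

StepwiseIncreasing : ∀ {m} → (Fin (suc n) → Fin m) → Fin (suc n) → Fin (suc n) → Set
StepwiseIncreasing f r s = ∀ i → r Fin.≤ inject₁ i → suc i Fin.≤ s → f (inject₁ i) < f (suc i)

stepwiseIncreasing⇒< : ∀ {m} (f : Fin (suc n) → Fin m) {r s : Fin (suc n)} →
  r < s → StepwiseIncreasing f r s → f r < f s
stepwiseIncreasing⇒< {n = n} f {r} {s} = <-weakInduction Goal (λ ()) step s
  where
  Goal : Fin (suc n) → Set
  Goal s = r < s → StepwiseIncreasing f r s → f r < f s

  step : ∀ j → Goal (inject₁ j) → Goal (suc j)
  step j ih r<1+j inc with Fin.<-cmp r (inject₁ j)
  ... | tri< r<j _ _  =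
    Fin.<-trans (ih r<j (λ i r≤i 1+i≤j → inc i r≤i (Fin.i≤inject₁[j]⇒i≤1+j 1+i≤j))) last
    where last = inc j (Fin.<⇒≤pred r<1+j) Fin.≤-refl
  ... | tri≈ _ refl _ = inc j Fin.≤-refl Fin.≤-refl
  ... | tri> _ _ j<r  = contradiction j<r (ℕ.≤⇒≯ (Fin.<⇒≤pred r<1+j))

csucc-inject₁ : (i : Fin n) → csucc (inject₁ i) ≡ suc i
csucc-inject₁ {suc n} zero    = refl
csucc-inject₁ {suc n} (suc i) rewrite csucc-inject₁ i = refl

csucc-fromℕ : ∀ n → csucc (fromℕ n) ≡ zero
csucc-fromℕ zero    = refl
csucc-fromℕ (suc n) rewrite csucc-fromℕ n = refl

fromℕ-or-inject₁ : (p : Fin (suc n)) → p ≡ fromℕ n ⊎ ∃ λ i → p ≡ inject₁ i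
fromℕ-or-inject₁ p with view p
... | ‵fromℕ     = inj₁ refl
... | ‵inject₁ i = inj₂ (i , refl)

csucc-injective : {p q : Fin (suc n)} → csucc p ≡ csucc q → p ≡ q
csucc-injective {n} {p} {q} eq with view p | view q
... | ‵fromℕ     | ‵fromℕ     = refl
... | ‵fromℕ     | ‵inject₁ j =
  contradiction (trans (sym (csucc-fromℕ n)) (trans eq (csucc-inject₁ j))) λ ()
... | ‵inject₁ i | ‵fromℕ     =
  contradiction (trans (sym (csucc-fromℕ n)) (trans (sym eq) (csucc-inject₁ i))) λ ()
... | ‵inject₁ i | ‵inject₁ j =
  cong inject₁ (Fin.suc-injective (trans (sym (csucc-inject₁ i)) (trans eq (csucc-inject₁ j))))

⟨$⟩ʳ-injective : (π : Permutation′ n) {r s : Fin n} → π ⟨$⟩ʳ r ≡ π ⟨$⟩ʳ s → r ≡ s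
⟨$⟩ʳ-injective π = Injection.injective (↔⇒↣ π)

Φ-injective : (π : Permutation′ (suc n)) {r s : Fin (suc n)} → Φ π r ≡ Φ π s → r ≡ s
Φ-injective π eq =
  ⟨$⟩ʳ-injective π (csucc-injective (trans (sym (inverseʳ π)) (trans (cong (π ⟨$⟩ʳ_) eq) (inverseʳ π))))

⟨$⟩ʳ-Φ : (π : Permutation′ (suc n)) {r : Fin (suc n)} {i : Fin n} →
  π ⟨$⟩ʳ r ≡ inject₁ i → π ⟨$⟩ʳ Φ π r ≡ suc i
⟨$⟩ʳ-Φ π {i = i} eq = trans (inverseʳ π) (trans (cong csucc eq) (csucc-inject₁ i))

Φ-⟨$⟩ˡ-inject₁ : (π : Permutation′ (suc n)) (i : Fin n) →
  Φ π (π ⟨$⟩ˡ inject₁ i) ≡ π ⟨$⟩ˡ suc i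
Φ-⟨$⟩ˡ-inject₁ π i = cong (π ⟨$⟩ˡ_) (trans (cong csucc (inverseʳ π)) (csucc-inject₁ i))

rank≢zero⇒inject₁ : (π : Permutation′ (suc n)) → π ⟨$⟩ʳ zero ≡ fromℕ n →
  {r : Fin (suc n)} → r ≢ zero → ∃ λ i → π ⟨$⟩ʳ r ≡ inject₁ i
rank≢zero⇒inject₁ π π-zero {r} r≢0 with fromℕ-or-inject₁ (π ⟨$⟩ʳ r)
... | inj₁ eq = contradiction (⟨$⟩ʳ-injective π (trans eq (sym π-zero))) r≢0
... | inj₂ pos = pos

suffix-inject₁ : (u : Vec A (suc n)) (i : Fin n) →
  suffix u (inject₁ i) ≡ lookup u (inject₁ i) ∷ suffix u (suc i)
suffix-inject₁ (x ∷ u) zero    = refl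
suffix-inject₁ (x ∷ u) (suc i) = suffix-inject₁ u i

suffix-Φ : (u : Vec A (suc n)) (π : Permutation′ (suc n)) {r : Fin (suc n)} {i : Fin n} →
  π ⟨$⟩ʳ r ≡ inject₁ i →
  suffix u (π ⟨$⟩ʳ r) ≡ lookup u (π ⟨$⟩ʳ r) ∷ suffix u (π ⟨$⟩ʳ Φ π r)
suffix-Φ u π {r} {i} eq = begin
  suffix u (π ⟨$⟩ʳ r)                          ≡⟨ cong (suffix u) eq ⟩
  suffix u (inject₁ i)                         ≡⟨ suffix-inject₁ u i ⟩
  lookup u (inject₁ i) ∷ suffix u (suc i)
    ≡⟨ cong₂ (λ p q → lookup u p ∷ suffix u q) (sym eq) (sym (⟨$⟩ʳ-Φ π eq)) ⟩
  lookup u (π ⟨$⟩ʳ r) ∷ suffix u (π ⟨$⟩ʳ Φ π r) ∎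
  where open ≡-Reasoning

suffix-sharp-fromℕ : (w : Vec (Fin k) n) → suffix (sharp w) (fromℕ n) ≡ zero ∷ []
suffix-sharp-fromℕ []      = refl
suffix-sharp-fromℕ (x ∷ w) = suffix-sharp-fromℕ w

lookup-sharp-inject₁ : (w : Vec (Fin k) n) (i : Fin n) → lookup (sharp w) (inject₁ i) ≡ suc (lookup w i)
lookup-sharp-inject₁ (x ∷ w) zero    = refl
lookup-sharp-inject₁ (x ∷ w) (suc i) = lookup-sharp-inject₁ w i

sentinel-suffix-minimal : (w : Vec (Fin k) n) (i : Fin n) →
  suffix (sharp w) (fromℕ n) <lex suffix (sharp w) (inject₁ i)
sentinel-suffix-minimal w i
  rewrite suffix-sharp-fromℕ w | suffix-inject₁ (sharp w) i | lookup-sharp-inject₁ w i = this (s≤s z≤n)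

<lex-irrefl : {xs : List (Fin k)} → ¬ xs <lex xs
<lex-irrefl = Lex.<-irreflexive Fin.<-irrefl (Pointwise.≡⇒Pointwise-≡ refl)

<lex-asym : {xs ys : List (Fin k)} → xs <lex ys → ¬ ys <lex xs
<lex-asym = Lex.<-asymmetric sym Fin.<-resp₂-≡ Fin.<-asym

suffixArray-reflects : (u : Vec (Fin k) n) (π : Permutation′ n) → IsSuffixArray u π →
  {r s : Fin n} → suffix u (π ⟨$⟩ʳ r) <lex suffix u (π ⟨$⟩ʳ s) → r < s
suffixArray-reflects u π sa {r} {s} lt with Fin.<-cmp r s
... | tri< r<s _ _ = r<s
... | tri≈ _ refl _ = contradiction lt <lex-irrefl
... | tri> _ _ s<r = contradiction (sa s r s<r) (<lex-asym lt)

Descent : Permutation′ (suc n) → Pred (Fin n) 0ℓ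
Descent π i = toℕ i ≢ 0 × Φ π (suc i) < Φ π (inject₁ i)

descent? : (π : Permutation′ (suc n)) → Decidable (Descent π)
descent? π i = ¬? (toℕ i ℕ.≟ 0) ×-dec (Φ π (suc i) Fin.<? Φ π (inject₁ i))

descentCount≡countBelow : (π : Permutation′ (suc n)) →
  descentCount π ≡ countBelow (descent? π) (fromℕ n)
descentCount≡countBelow π = length-filter-tabulate (descent? π) (λ i → i)

module Necessity (w : Vec (Fin k) n) (π : Permutation′ (suc n)) (sa : IsSuffixArray (sharp w) π) where

  private
    u = sharp w

  π-zero : π ⟨$⟩ʳ zero ≡ fromℕ n
  π-zero with fromℕ-or-inject₁ (π ⟨$⟩ʳ zero)
  ... | inj₁ eq      = eq
  ... | inj₂ (i , eq) = contradiction (suffixArray-reflects u π sa sentinel<first) ℕ.n≮0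
    where
    sentinel<first : suffix u (π ⟨$⟩ʳ (π ⟨$⟩ˡ fromℕ n)) <lex suffix u (π ⟨$⟩ʳ zero)
    sentinel<first = subst₂ _<lex_ (cong (suffix u) (sym (inverseʳ π))) (cong (suffix u) (sym eq))
                       (sentinel-suffix-minimal w i)

  letter : Fin (suc n) → Fin (suc k)
  letter r = lookup u (π ⟨$⟩ʳ r)

  letter-step : {r s : Fin (suc n)} → r < s → toℕ r ≢ 0 →
    letter r < letter s ⊎ (letter r ≡ letter s × Φ π r < Φ π s)
  letter-step {r} {s} r<s r≢0
    with rank≢zero⇒inject₁ π π-zero (r≢0 ∘ cong toℕ)
       | rank≢zero⇒inject₁ π π-zero {s} (λ { refl → ℕ.n≮0 r<s })
  ... | _ , er | _ , es with subst₂ _<lex_ (suffix-Φ u π er) (suffix-Φ u π es) (sa r s r<s)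
  ...   | this r<ₗs      = inj₁ r<ₗs
  ...   | next r≡ₗs rest = inj₂ (r≡ₗs , suffixArray-reflects u π sa rest)

  letter-step-suc : (i : Fin n) → toℕ i ≢ 0 →
    letter (inject₁ i) < letter (suc i) ⊎
    (letter (inject₁ i) ≡ letter (suc i) × Φ π (inject₁ i) < Φ π (suc i))
  letter-step-suc i i≢0 =
    letter-step (Fin.≤̄⇒inject₁< Fin.≤-refl) (i≢0 ∘ trans (sym (Fin.toℕ-inject₁ i)))

  letter-mono : (i : Fin n) → toℕ i ≢ 0 → letter (inject₁ i) Fin.≤ letter (suc i)
  letter-mono i i≢0 with letter-step-suc i i≢0
  ... | inj₁ lt       = ℕ.<⇒≤ lt
  ... | inj₂ (eq , _) = Fin.≤-reflexive eq

  letter-strict : (i : Fin n) → Descent π i → letter (inject₁ i) < letter (suc i)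
  letter-strict i (i≢0 , Φ>) with letter-step-suc i i≢0
  ... | inj₁ lt       = lt
  ... | inj₂ (_ , Φ<) = contradiction Φ> (Fin.<-asym Φ<)

descentCount-bound : (w : Vec (Fin k) n) (π : Permutation′ (suc n)) → IsSuffixArray (sharp w) π →
  descentCount π ≤ k ∸ 1
descentCount-bound {n = zero}    w π sa = z≤n
descentCount-bound {k} {suc n} w π sa = ℕ.m+n≤o⇒m≤o∸n _ (begin
  descentCount π + 1
    -- index 0 is never a descent, so the count reduces definitionally to indices ≥ 1
    ≡⟨ cong (_+ 1) (descentCount≡countBelow π) ⟩
  countBelow (descent? π ∘ suc) (fromℕ n) + 1
    ≤⟨ ℕ.+-monoʳ-≤ _ first-letter-positive ⟩
  countBelow (descent? π ∘ suc) (fromℕ n) + ℓ zero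
    ≤⟨ countBelow-growth (descent? π ∘ suc) ℓ
         (λ i → letter-mono (suc i) (λ ())) (letter-strict ∘ suc) (fromℕ n) ⟩
  ℓ (fromℕ n)
    ≤⟨ Fin.toℕ≤pred[n] (letter (fromℕ (suc n))) ⟩
  k ∎)
  where
  open Necessity w π sa
  open ℕ.≤-Reasoning
  ℓ : Fin (suc n) → ℕ
  ℓ r = toℕ (letter (suc r))
  first-letter-positive : 1 ≤ ℓ zero
  first-letter-positive with rank≢zero⇒inject₁ π π-zero {suc zero} (λ ())
  ... | i , eq rewrite eq | lookup-sharp-inject₁ w i = s≤s z≤n

module Sufficiency (π : Permutation′ (suc n)) (π-zero : π ⟨$⟩ʳ zero ≡ fromℕ n)
                   (bound : descentCount π ≤ k) where

  S : Fin (suc n) → ℕ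
  S = countBelow (descent? π)

  S≤k : ∀ r → S r ≤ k
  S≤k r = ℕ.≤-trans (countBelow-mono (descent? π) (Fin.≤fromℕ r))
                    (subst (_≤ k) (descentCount≡countBelow π) bound)

  w : Vec (Fin (suc k)) n
  w = tabulate λ i → fromℕ< (s≤s (S≤k (π ⟨$⟩ˡ inject₁ i)))

  u : Vec (Fin (suc (suc k))) (suc n)
  u = sharp w

  toℕ-letter : {r : Fin (suc n)} {i : Fin n} → π ⟨$⟩ʳ r ≡ inject₁ i →
    toℕ (lookup u (π ⟨$⟩ʳ r)) ≡ suc (S r)
  toℕ-letter {r} {i} eq = begin
    toℕ (lookup u (π ⟨$⟩ʳ r))   ≡⟨ cong (toℕ ∘ lookup u) eq ⟩
    toℕ (lookup u (inject₁ i))  ≡⟨ cong toℕ (lookup-sharp-inject₁ w i) ⟩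
    suc (toℕ (lookup w i))      ≡⟨ cong (suc ∘ toℕ) (Vec.lookup∘tabulate _ i) ⟩
    suc (toℕ (fromℕ< _))        ≡⟨ cong suc (Fin.toℕ-fromℕ< _) ⟩
    suc (S (π ⟨$⟩ˡ inject₁ i))  ≡⟨ cong (suc ∘ S) (trans (cong (π ⟨$⟩ˡ_) (sym eq)) (inverseˡ π)) ⟩
    suc (S r)                   ∎
    where open ≡-Reasoning

  nonDescent⇒Φ< : (i : Fin n) → toℕ i ≢ 0 → ¬ Descent π i → Φ π (inject₁ i) < Φ π (suc i)
  nonDescent⇒Φ< i i≢0 ¬descent = Fin.≤∧≢⇒< (ℕ.≮⇒≥ (¬descent ∘ (i≢0 ,_)))
    (Fin.<⇒≢ (Fin.≤̄⇒inject₁< Fin.≤-refl) ∘ Φ-injective π)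

  plateau⇒Φ< : {r s : Fin (suc n)} → r < s → r ≢ zero → S r ≡ S s → Φ π r < Φ π s
  plateau⇒Φ< {r} {s} r<s r≢0 Sr≡Ss = stepwiseIncreasing⇒< (Φ π) r<s λ i r≤i 1+i≤s →
    nonDescent⇒Φ< i (toℕ≢0 r≢0 r≤i) (countBelow-plateau (descent? π) Sr≡Ss r≤i 1+i≤s)
    where
    toℕ≢0 : {r : Fin (suc n)} {i : Fin n} → r ≢ zero → r Fin.≤ inject₁ i → toℕ i ≢ 0
    toℕ≢0 {zero}  r≢0 _ = contradiction refl r≢0
    toℕ≢0 {suc r} {zero}  _ ()
    toℕ≢0 {suc r} {suc i} _ _ ()

  SuffixesIncreaseFrom : Fin (suc n) → Set
  SuffixesIncreaseFrom r = ∀ s → r < s → suffix u (π ⟨$⟩ʳ r) <lex suffix u (π ⟨$⟩ʳ s)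

  sentinel-first : SuffixesIncreaseFrom zero
  sentinel-first s 0<s with rank≢zero⇒inject₁ π π-zero {s} (λ { refl → ℕ.n≮0 0<s })
  ... | j , es = subst₂ _<lex_ (cong (suffix u) (sym π-zero)) (cong (suffix u) (sym es))
                   (sentinel-suffix-minimal w j)

  increase-step : {r : Fin (suc n)} {i : Fin n} → π ⟨$⟩ʳ r ≡ inject₁ i →
    SuffixesIncreaseFrom (Φ π r) → SuffixesIncreaseFrom r
  increase-step {r} er ih s r<s with rank≢zero⇒inject₁ π π-zero {s} (λ { refl → ℕ.n≮0 r<s })
  ... | j , es = subst₂ _<lex_ (sym (suffix-Φ u π er)) (sym (suffix-Φ u π es)) heads
    where
    r≢0 : r ≢ zero
    r≢0 refl = Fin.fromℕ≢inject₁ (trans (sym π-zero) er)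
    heads : (lookup u (π ⟨$⟩ʳ r) ∷ suffix u (π ⟨$⟩ʳ Φ π r))
              <lex (lookup u (π ⟨$⟩ʳ s) ∷ suffix u (π ⟨$⟩ʳ Φ π s))
    heads with ℕ.m≤n⇒m<n∨m≡n (countBelow-mono (descent? π) (ℕ.<⇒≤ r<s))
    ... | inj₁ Sr<Ss = this (subst₂ ℕ._<_ (sym (toℕ-letter er)) (sym (toℕ-letter es)) (s≤s Sr<Ss))
    ... | inj₂ Sr≡Ss = next
      (Fin.toℕ-injective (trans (toℕ-letter er) (trans (cong suc Sr≡Ss) (sym (toℕ-letter es)))))
      (ih (Φ π s) (plateau⇒Φ< r<s r≢0 Sr≡Ss))

  isSuffixArray : IsSuffixArray u π
  isSuffixArray r = subst SuffixesIncreaseFrom (inverseˡ π)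
    (>-weakInduction (SuffixesIncreaseFrom ∘ (π ⟨$⟩ˡ_)) last step (π ⟨$⟩ʳ r))
    where
    last : SuffixesIncreaseFrom (π ⟨$⟩ˡ fromℕ n)
    last = subst SuffixesIncreaseFrom (sym (trans (cong (π ⟨$⟩ˡ_) (sym π-zero)) (inverseˡ π)))
                 sentinel-first
    step : ∀ i → SuffixesIncreaseFrom (π ⟨$⟩ˡ suc i) → SuffixesIncreaseFrom (π ⟨$⟩ˡ inject₁ i)
    step i ih = increase-step (inverseʳ π) (subst SuffixesIncreaseFrom (sym (Φ-⟨$⟩ˡ-inject₁ π i)) ih)

mainTheorem5 : (k : ℕ) → 1 ≤ k → (n : ℕ) → (π : Permutation′ (suc n)) →
    (∃ λ (w : Vec (Fin k) n) → IsSuffixArray (sharp w) π)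
      ⇔ ((descentCount π ≤ k ∸ 1) × (π ⟨$⟩ʳ zero ≡ fromℕ n))
mainTheorem5 zero    ()  n π
mainTheorem5 (suc k) _   n π = mk⇔
  (λ (w , sa) → descentCount-bound w π sa , Necessity.π-zero w π sa)
  (λ (bound , π-zero) → Sufficiency.w π π-zero bound , Sufficiency.isSuffixArray π π-zero bound)
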